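{- Let $G=(V,E)$ be a strongly connected $d$-out digraph, let $S=\langle R_1,\ldots,R_d\rangle$ be a coloring semigroup of $G$ with kernel $\mathcal K$, and let $W\in S$ and $B=\operatorname{range}(W)$. Then $B$ is an $F$-clique if and only if $W\in\mathcal K$.
   Context: A $d$-out digraph has every vertex of out-degree $d$ (multiple edges allowed). A coloring is a decomposition of the adjacency matrix $\mathcal A=R_1+\cdots+R_d$ into 0-1 stochastic matrices, each identified with a map $V\to V$ ($jR_i=k$ iff $(R_i)_{jk}=1$; maps act on the right). The coloring semigroup $S$ is the finite semigroup they generate under composition, and its kernel $\mathcal K$ is its minimal ideal. For $W\in S$, $\operatorname{range}(W)=\{xW: x\in V\}$. A set $B=\operatorname{range}(W)$ with $W\in S$ is an $F$-clique if for every pair $x\ne y$ in $B$ and every $U\in S$, $xU\ne yU$. -}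

module Defs where

open import Level using (Level; suc; _⊔_) renaming (zero to lzero)
open import Data.Nat using (ℕ)
open import Data.Fin using (Fin)
open import Data.Product using (Σ; ∃; _×_; _,_)
open import Data.List.NonEmpty using (List⁺; _∷_; toList)
open import Data.List using (List; []; _∷_; foldl)
open import Relation.Binary.PropositionalEquality using (_≡_; _≢_)
open import Function using (_∘_)

-- Vertices are Fin n. A map V → V is a function Fin n → Fin n.
-- Maps act on the right: x(UV) = (xU)V, i.e. the product UV is the
-- function V ∘ U.
Map : ℕ → Set
Map n = Fin n → Fin n

_≈_ : ∀ {n} → Map n → Map n → Set
f ≈ g = ∀ x → f x ≡ g x

-- A coloring of a d-out digraph on Fin n: d maps R₁,…,R_d (0-1 stochastic
-- matrices).  The digraph is the one with adjacency matrix R₁+⋯+R_d, i.e. for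
-- each vertex x and colour i there is an edge x → x R_i (multi-edges allowed).
Coloring : ℕ → ℕ → Set
Coloring d n = Fin d → Map n

data Walk {d n : ℕ} (R : Coloring d n) : Fin n → Fin n → Set where
  here : ∀ {x} → Walk R x x
  step : ∀ {x y} (i : Fin d) → Walk R (R i x) y → Walk R x y

StronglyConnected : ∀ {d n} → Coloring d n → Set
StronglyConnected R = ∀ x y → Walk R x y

act : ∀ {d n} → Coloring d n → List (Fin d) → Fin n → Fin n
act R w x = foldl (λ y i → R i y) x w

InS : ∀ {d n} → Coloring d n → Map n → Set
InS R f = Σ (List⁺ _) λ w → f ≈ act R (toList w)

record IsIdeal {d n : ℕ} (R : Coloring d n) (I : Map n → Set) : Set₁ where
  field
    respects : ∀ {f g} → f ≈ g → I f → I g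
    sub      : ∀ {f} → I f → InS R f
    nonempty : Σ (Map n) I
    closedʳ  : ∀ {f u} → I f → InS R u → I (u ∘ f)   -- f·u
    closedˡ  : ∀ {f u} → I f → InS R u → I (f ∘ u)   -- u·f

-- The kernel (minimal ideal) of the finite semigroup S: the intersection of
-- all ideals of S (which is itself an ideal, hence the unique minimal one).
InKernel : ∀ {d n} → Coloring d n → Map n → Set₁
InKernel {d} {n} R W = ∀ (I : Map n → Set) → IsIdeal R I → I W

InRange : ∀ {n} → Map n → Fin n → Set
InRange W b = ∃ λ x → W x ≡ b

FClique : ∀ {d n} → Coloring d n → Map n → Set
FClique R W = ∀ x y → InRange W x → InRange W y → x ≢ y →
              ∀ U → InS R U → U x ≢ U y

-- If range(W) is an F-clique and f lies in an ideal I, then g = fW ∈ S is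
-- injective on range(W) and maps V into range(W), so it permutes range(W) and
-- some power fixes it pointwise: W = W g^(k+1) = (WfW) g^k ∈ I.  Conversely, if
-- W is in the kernel and U ∈ S merges two points of range(W), then W lies in
-- the ideal generated by WU, i.e. W = cWUa for maps a, c.  With f = Ua, iterating
-- W = cWf shows every point of range(W) is f-periodic; a common period k gives
-- xW = xW f^(k+1) = xWU a f^k for all x, so the merged points coincide.
module Submission where

open import Defs
open import Data.Nat using (ℕ; zero; suc; _+_; _*_)
open import Data.Nat.Properties using (n<1+n; m≤n⇒∃[o]m+o≡n; +-comm; *-comm)
open import Data.Product using (_×_; _,_; proj₁; proj₂; ∃; ∃₂)
open import Data.Fin using (Fin; toℕ; _≟_) renaming (zero to fzero; suc to fsuc)
open import Data.Fin.Properties using (pigeonhole)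
open import Data.List using (_∷_; _++_)
open import Data.List.NonEmpty using (_∷_; toList)
open import Data.List.Properties using (foldl-++)
open import Data.Empty using (⊥-elim)
open import Relation.Nullary using (yes; no)
open import Relation.Binary.PropositionalEquality
open import Function using (_∘_; id)

module _ {n : ℕ} where
  open import Function.Endo.Propositional (Fin n) using (_^_; ^-homo)

  ^-+ : ∀ (f : Map n) a b z → (f ^ (a + b)) z ≡ (f ^ a) ((f ^ b) z)
  ^-+ f a b = cong-app (^-homo f a b)

  ^-comm : ∀ (f : Map n) a b z → (f ^ a) ((f ^ b) z) ≡ (f ^ b) ((f ^ a) z)
  ^-comm f a b z = begin
    (f ^ a) ((f ^ b) z) ≡⟨ ^-+ f a b z ⟨
    (f ^ (a + b)) z     ≡⟨ cong (λ m → (f ^ m) z) (+-comm a b) ⟩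
    (f ^ (b + a)) z     ≡⟨ ^-+ f b a z ⟩
    (f ^ b) ((f ^ a) z) ∎
    where open ≡-Reasoning

  ^-sucʳ : ∀ (f : Map n) k z → (f ^ suc k) z ≡ (f ^ k) (f z)
  ^-sucʳ f k z = ^-comm f 1 k z

  Periodic : Map n → Fin n → Set
  Periodic f z = ∃ λ p → (f ^ suc p) z ≡ z

  period-multiple : ∀ {f : Map n} {z p} → (f ^ suc p) z ≡ z → ∀ c → (f ^ (c * suc p)) z ≡ z
  period-multiple             fix zero    = refl
  period-multiple {f} {z} {p} fix (suc c) = begin
    (f ^ (suc p + c * suc p)) z       ≡⟨ ^-+ f (suc p) (c * suc p) z ⟩
    (f ^ suc p) ((f ^ (c * suc p)) z) ≡⟨ cong (f ^ suc p) (period-multiple fix c) ⟩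
    (f ^ suc p) z                     ≡⟨ fix ⟩
    z                                 ∎
    where open ≡-Reasoning

  periodic-^ : ∀ {f : Map n} {z} → Periodic f z → ∀ i → Periodic f ((f ^ i) z)
  periodic-^ {f} {z} (p , fix) i = p , trans (^-comm f (suc p) i z) (cong (f ^ i) fix)

  eventuallyPeriodic : ∀ (f : Map n) z → ∃ λ i → Periodic f ((f ^ i) z)
  eventuallyPeriodic f z with pigeonhole (n<1+n n) (λ k → (f ^ toℕ k) z)
  ... | i , j , i<j , fⁱz≡fʲz with m≤n⇒∃[o]m+o≡n i<j
  ... | p , i+p≡j = toℕ i , p , (begin
    (f ^ suc p) ((f ^ toℕ i) z) ≡⟨ ^-+ f (suc p) (toℕ i) z ⟨
    (f ^ (suc p + toℕ i)) z     ≡⟨ cong (λ m → (f ^ suc m) z) (+-comm p (toℕ i)) ⟩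
    (f ^ (suc (toℕ i) + p)) z   ≡⟨ cong (λ m → (f ^ m) z) i+p≡j ⟩
    (f ^ toℕ j) z               ≡⟨ fⁱz≡fʲz ⟨
    (f ^ toℕ i) z               ∎)
    where open ≡-Reasoning

  commonPeriod : ∀ (f : Map n) {m} (h : Fin m → Fin n) → (∀ x → Periodic f (h x)) →
                 ∃ λ k → ∀ x → (f ^ suc k) (h x) ≡ h x
  commonPeriod f {zero}  h periodic = 0 , λ ()
  commonPeriod f {suc m} h periodic with periodic fzero | commonPeriod f (h ∘ fsuc) (periodic ∘ fsuc)
  ... | p , fix₀ | k , fix = k + p * suc k , λ
    { fzero    → subst (λ e → (f ^ e) (h fzero) ≡ h fzero) (*-comm (suc k) (suc p))
                       (period-multiple {f} {p = p} fix₀ (suc k))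
    ; (fsuc x) → period-multiple {f} {p = k} (fix x) (suc p)
    }

  injectiveOn⇒periodic : ∀ (f : Map n) (P : Fin n → Set) → (∀ z → P (f z)) →
                         (∀ {y z} → P y → P z → f y ≡ f z → y ≡ z) →
                         ∀ {z} → P z → Periodic f z
  injectiveOn⇒periodic f P into injective {z} Pz with eventuallyPeriodic f z
  ... | i , p , fix = p , cancel i (P-^ (suc p) Pz) Pz (trans (^-comm f i (suc p) z) fix)
    where
      P-^ : ∀ k {y} → P y → P ((f ^ k) y)
      P-^ zero    Py = Py
      P-^ (suc k) _  = into _
      cancel : ∀ k {y z} → P y → P z → (f ^ k) y ≡ (f ^ k) z → y ≡ z
      cancel zero    _  _  eq = eq
      cancel (suc k) Py Pz eq = cancel k Py Pz (injective (P-^ k Py) (P-^ k Pz) eq)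

  range-periodic : ∀ {f c W : Map n} → (∀ x → W x ≡ f (W (c x))) → ∀ x → Periodic f (W x)
  range-periodic {f = f} {c = c} {W} W≡fWc x with eventuallyPeriodic c x
  ... | i , p , fix = subst (Periodic f) (sym (unfold i x)) (periodic-^ (p , sym Wy-fixed) i)
    where
      unfold : ∀ m x → W x ≡ (f ^ m) (W ((c ^ m) x))
      unfold zero    x = refl
      unfold (suc m) x = begin
        W x                             ≡⟨ W≡fWc x ⟩
        f (W (c x))                     ≡⟨ cong f (unfold m (c x)) ⟩
        f ((f ^ m) (W ((c ^ m) (c x)))) ≡⟨ cong (λ y → f ((f ^ m) (W y))) (^-sucʳ c m x) ⟨
        f ((f ^ m) (W ((c ^ suc m) x))) ∎
        where open ≡-Reasoning
      y = (c ^ i) x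
      Wy-fixed : W y ≡ (f ^ suc p) (W y)
      Wy-fixed = trans (unfold (suc p) y) (cong (λ t → (f ^ suc p) (W t)) fix)

module _ {d n : ℕ} (R : Coloring d n) where
  open import Function.Endo.Propositional (Fin n) using (_^_)

  InS-resp : ∀ {f g} → f ≈ g → InS R f → InS R g
  InS-resp f≈g (w , e) = w , λ x → trans (sym (f≈g x)) (e x)

  InS-∘ : ∀ {a b} → InS R a → InS R b → InS R (a ∘ b)
  InS-∘ {a} {b} (w , a≈w) (i ∷ v , b≈iv) = (i ∷ (v ++ toList w)) , λ x →
    trans (cong a (b≈iv x)) (trans (a≈w _) (sym (foldl-++ (λ y j → R j y) x (i ∷ v) (toList w))))

  InS-^ : ∀ {g h} → InS R g → InS R h → ∀ k → InS R ((g ^ k) ∘ h)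
  InS-^ sg sh zero    = sh
  InS-^ sg sh (suc k) = InS-∘ sg (InS-^ sg sh k)

  FactorsThrough : Map n → Map n → Set
  FactorsThrough V W = ∃₂ λ a c → W ≈ (a ∘ V ∘ c)

  factorsThrough-isIdeal : ∀ {V} → InS R V → IsIdeal R (λ W → InS R W × FactorsThrough V W)
  factorsThrough-isIdeal {V} sV = record
    { respects = λ { f≈g (sf , a , c , f≈aVc) → InS-resp f≈g sf , a , c , λ z → trans (sym (f≈g z)) (f≈aVc z) }
    ; sub      = proj₁
    ; nonempty = V , sV , id , id , λ _ → refl
    ; closedʳ  = λ { {u = u} (sf , a , c , f≈aVc) su → InS-∘ su sf , u ∘ a , c , λ z → cong u (f≈aVc z) }
    ; closedˡ  = λ { {u = u} (sf , a , c , f≈aVc) su → InS-∘ sf su , a , c ∘ u , λ z → f≈aVc (u z) }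
    }

  InKernel⇒factorsThrough : ∀ {W V} → InKernel R W → InS R V → FactorsThrough V W
  InKernel⇒factorsThrough W∈K sV = proj₂ (W∈K _ (factorsThrough-isIdeal sV))

  FClique⇒InKernel : ∀ {W} → InS R W → FClique R W → InKernel R W
  FClique⇒InKernel {W} sW clique I isI =
    respects (λ x → sym (W≡gᵏWfW x)) (closedʳ (closedˡ If sW) (InS-^ sg sW k))
    where
      open IsIdeal isI
      f = proj₁ nonempty
      If = proj₂ nonempty
      g = W ∘ f
      sg : InS R g
      sg = InS-∘ sW (sub If)
      g-injective : ∀ {y z} → InRange W y → InRange W z → g y ≡ g z → y ≡ z
      g-injective {y} {z} Wy Wz gy≡gz with y ≟ z
      ... | yes y≡z = y≡z
      ... | no  y≢z = ⊥-elim (clique y z Wy Wz y≢z g sg gy≡gz)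
      period = commonPeriod g W (λ x → injectiveOn⇒periodic g (InRange W) (λ z → f z , refl) g-injective (x , refl))
      k = proj₁ period
      W≡gᵏWfW : ∀ x → W x ≡ (g ^ k) (W (f (W x)))
      W≡gᵏWfW x = trans (sym (proj₂ period x)) (^-sucʳ g k (W x))

  InKernel⇒FClique : ∀ {W} → InS R W → InKernel R W → FClique R W
  InKernel⇒FClique {W} sW W∈K .(W x) .(W y) (x , refl) (y , refl) Wx≢Wy U sU UWx≡UWy =
    Wx≢Wy (begin
      W x                   ≡⟨ fix x ⟨
      (f ^ k) (a (U (W x))) ≡⟨ cong (λ t → (f ^ k) (a t)) UWx≡UWy ⟩
      (f ^ k) (a (U (W y))) ≡⟨ fix y ⟩
      W y                   ∎)
    where
      open ≡-Reasoning
      factorization = InKernel⇒factorsThrough W∈K (InS-∘ sU sW)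
      a = proj₁ factorization
      c = proj₁ (proj₂ factorization)
      f = a ∘ U
      period = commonPeriod f W (range-periodic {f = f} {c = c} (proj₂ (proj₂ factorization)))
      k = proj₁ period
      fix : ∀ z → (f ^ k) (f (W z)) ≡ W z
      fix z = trans (sym (^-sucʳ f k (W z))) (proj₂ period z)

mainTheorem4 : ∀ {d n : ℕ} (R : Coloring d n) → StronglyConnected R →
               ∀ (W : Map n) → InS R W →
               (FClique R W → InKernel R W) × (InKernel R W → FClique R W)
mainTheorem4 R _ W sW = FClique⇒InKernel R sW , InKernel⇒FClique R sW
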